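{- Let $a, b$ be nonzero integers with $|a| \neq 1$. Then there exist constants $c>0$ and $x_0$, depending on $a$ and $b$, such that for all $x \geq x_0$, $$\#\{p \leq x \text{ prime} : p \nmid ab \text{ and } b \bmod p \in \langle a \bmod p \rangle \subset \mathbb{F}_p^*\} \geq c \log\log x .$$
   Context: Here $\langle a \bmod p\rangle$ denotes the cyclic subgroup of the multiplicative group $\mathbb{F}_p^*$ generated by the residue of $a$ modulo $p$; the condition $b \bmod p \in \langle a \bmod p\rangle$ means $b \equiv a^n \pmod p$ for some integer $n \geq 0$. -}

module Defs where

open import Data.Nat using (ℕ)
open import Data.Nat.Primality using (Prime)
open import Data.Integer using (ℤ; +_; _*_; _-_; _^_)
open import Data.Integer.Divisibility using (_∣_)
open import Data.Product using (_×_; ∃)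
open import Relation.Nullary using (¬_)

-- b mod p lies in the cyclic subgroup ⟨a mod p⟩ of 𝔽_p^*:
-- b ≡ a^n (mod p) for some n ≥ 0.
InSubgroupMod : ℤ → ℤ → ℕ → Set
InSubgroupMod a b p = ∃ λ (n : ℕ) → (+ p) ∣ (b - a ^ n)

GoodPrime : ℤ → ℤ → ℕ → Set
GoodPrime a b p = Prime p × ¬ ((+ p) ∣ (a * b)) × InSubgroupMod a b p

module Submission where

-- A prime dividing Y n = |b - a ^ n| but not a is good.  Given a list S of t good primes,
-- consider the window Y (N + j), j ≤ t, for a large N = N t.  A power of a prime p ∤ a dividing
-- two members of the window divides a ^ (N + j) * (a ^ (j′ - j) - 1), hence E t = ∏_{d ≤ t} |a ^ d - 1|.
-- So each p ∈ S is "untame" at no more than one index and, by pigeonhole, some member Y of the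
-- window has its S-part dividing E t, while its part at primes of a divides b.  As Y > |b| * E t,
-- some prime power divides Y but not |b| * E t: its prime is a new good prime, of size at most
-- Bd t = 2 ^ (K * (N + t)).  Iterating, ℓ distinct good primes lie below 2 ^ 2 ^ (C * (ℓ + 1)),
-- and inverting this doubly exponential bound gives the log log x count.

open import Defs
open import Data.Nat using (ℕ; _≤_; _*_; suc)
open import Data.Nat.Logarithm using (⌊log₂_⌋)
open import Data.Integer using (ℤ; ∣_∣) renaming (0ℤ to zeroℤ)
open import Data.List using (List; length)
open import Data.List.Relation.Unary.All using (All)
open import Data.List.Relation.Unary.Unique.Propositional using (Unique)
open import Data.Product using (_×_; ∃)
open import Relation.Binary.PropositionalEquality using (_≢_)

open import Data.Nat
open import Data.Nat.Properties
open import Data.Nat.Divisibility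
open import Data.Nat.Induction using (<-rec)
open import Data.Nat.DivMod using (_/_; _%_; m≡m%n+[m/n]*n; m%n<n; m/n*n≤m; m*n/n≡m; /-monoˡ-≤)
open import Data.Nat.Logarithm using (⌊log₂⌋-mono-≤; ⌊log₂[2^n]⌋≡n; ⌊log₂⌊n/2⌋⌋≡⌊log₂n⌋∸1)
open import Data.Nat.Tactic.RingSolver using (solve-∀)
open import Data.Nat.Primality
  using (Prime; prime; prime?; euclidsLemma; ¬prime[1]; prime⇒nonZero; prime⇒nonTrivial;
         prime⇒irreducible; composite?; composite)
open import Data.Product using (_,_; proj₂)
open import Data.Sum using (inj₁; inj₂; [_,_])
import Data.Integer as Z
import Data.Integer.Properties as ZP
import Data.Integer.Divisibility.Signed as ZS
import Data.Integer.Tactic.RingSolver as ZR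
open import Data.Empty using (⊥-elim)
open import Relation.Nullary using (¬_; Dec; yes; no)
open import Data.List using ([]; _∷_)
import Data.List.Relation.Unary.All as All
open import Data.List.Relation.Unary.All using (all?; lookupAny)
open import Data.List.Relation.Unary.All.Properties using (¬All⇒Any¬; ¬Any⇒All¬; ─⁺; ─⁻)
open import Data.List.Membership.Propositional using (_∉_)
import Data.List.Relation.Unary.AllPairs as AllPairs
open import Data.List.Relation.Unary.Any using (Any; _─_)
import Data.List.Relation.Unary.Any as Any
open import Data.List.Properties using (length-removeAt′)
open import Function using (_∘_)
open import Relation.Nullary.Decidable using (_×-dec_; _→-dec_; ¬?)
open import Relation.Binary.Definitions using (tri<; tri≈; tri>)
open import Relation.Binary.PropositionalEquality
  using (_≡_; refl; sym; trans; cong; subst; subst₂; module ≡-Reasoning)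

prime≥2 : ∀ {p} → Prime p → 2 ≤ p
prime≥2 {p} p-prime = nonTrivial⇒n>1 p {{prime⇒nonTrivial p-prime}}

n<2^n : ∀ n → n < 2 ^ n
n<2^n zero    = s≤s z≤n
n<2^n (suc n) = +-mono-≤ (m^n>0 2 n) (≤-trans (n<2^n n) (m≤m+n (2 ^ n) 0))

^-monoʳ-∣ : ∀ p {e f} → e ≤ f → p ^ e ∣ p ^ f
^-monoʳ-∣ p {f = f} z≤n     = 1∣ (p ^ f)
^-monoʳ-∣ p         (s≤s e≤f) = *-monoʳ-∣ p (^-monoʳ-∣ p e≤f)

^-monoˡ-∣ : ∀ {m x} k → m ∣ x → m ^ k ∣ x ^ k
^-monoˡ-∣ zero    _   = ∣-refl
^-monoˡ-∣ (suc k) m∣x = *-pres-∣ m∣x (^-monoˡ-∣ k m∣x)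

prime∣^⇒∣ : ∀ {p x} → Prime p → ∀ n → p ∣ x ^ n → p ∣ x
prime∣^⇒∣ p-prime zero p∣1 = ⊥-elim (¬prime[1] (subst Prime (∣1⇒≡1 p∣1) p-prime))
prime∣^⇒∣ {x = x} p-prime (suc n) p∣x^1+n with euclidsLemma x (x ^ n) p-prime p∣x^1+n
... | inj₁ p∣x   = p∣x
... | inj₂ p∣x^n = prime∣^⇒∣ p-prime n p∣x^n

prime-power-cancel : ∀ {p x} → Prime p → ¬ p ∣ x → ∀ f {w} → p ^ f ∣ x * w → p ^ f ∣ w
prime-power-cancel _ _ zero {w} _ = 1∣ w
prime-power-cancel {p} {x} p-prime p∤x (suc f) {w} p^1+f∣xw
  with euclidsLemma x w p-prime (∣-trans (m∣m*n (p ^ f)) p^1+f∣xw)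
... | inj₁ p∣x = ⊥-elim (p∤x p∣x)
... | inj₂ (divides w′ refl) =
  subst (p * p ^ f ∣_) (*-comm p w′) (*-monoʳ-∣ p (prime-power-cancel p-prime p∤x f p^f∣xw′))
  where
  instance _ = prime⇒nonZero p-prime
  rearrange : x * (w′ * p) ≡ p * (x * w′)
  rearrange = trans (sym (*-assoc x w′ p)) (*-comm (x * w′) p)
  p^f∣xw′ : p ^ f ∣ x * w′
  p^f∣xw′ = *-cancelˡ-∣ p (subst (p * p ^ f ∣_) rearrange p^1+f∣xw)

prime∤prime : ∀ {r q} → Prime r → Prime q → r ≢ q → ¬ r ∣ q
prime∤prime r-prime q-prime r≢q r∣q with prime⇒irreducible q-prime r∣q
... | inj₁ refl = ¬prime[1] r-prime
... | inj₂ r≡q  = r≢q r≡q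

prime-divisor : ∀ n → 2 ≤ n → ∃ λ q → Prime q × q ∣ n
prime-divisor = <-rec _ search
  where
  search : ∀ n → (∀ {m} → m < n → 2 ≤ m → ∃ λ q → Prime q × q ∣ m) → 2 ≤ n → ∃ λ q → Prime q × q ∣ n
  search n ih 2≤n with composite? n
  ... | no  n-not-composite = n , prime {{n>1⇒nonTrivial 2≤n}} n-not-composite , ∣-refl
  ... | yes (composite {d} d<n d∣n) with ih d<n (nonTrivial⇒n>1 d)
  ...   | q , q-prime , q∣d = q , q-prime , ∣-trans q∣d d∣n

PrimePowersDivide : ℕ → ℕ → Set
PrimePowersDivide Y Z = ∀ q e → Prime q → q ^ e ∣ Y → q ^ e ∣ Z

strip-prime : ∀ {q Y′ Z′} → Prime q → PrimePowersDivide (Y′ * q) (Z′ * q) → PrimePowersDivide Y′ Z′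
strip-prime {q} {Y′} {Z′} q-prime powers r e r-prime r^e∣Y′ with r ≟ q
... | yes refl = *-cancelʳ-∣ r {{prime⇒nonZero r-prime}}
                   (subst (_∣ Z′ * r) (*-comm r (r ^ e)) (powers r (suc e) r-prime r^1+e∣Y′r))
  where
  r^1+e∣Y′r : r * r ^ e ∣ Y′ * r
  r^1+e∣Y′r = subst (_∣ Y′ * r) (*-comm (r ^ e) r) (*-monoˡ-∣ r r^e∣Y′)
... | no r≢q = prime-power-cancel r-prime (prime∤prime r-prime q-prime r≢q) e
                 (subst (r ^ e ∣_) (*-comm Z′ q) (powers r e r-prime (∣m⇒∣m*n q r^e∣Y′)))

prime-powers⇒∣ : ∀ Y Z → 0 < Y → PrimePowersDivide Y Z → Y ∣ Z
prime-powers⇒∣ = <-rec _ induct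
  where
  induct : ∀ Y → (∀ {Y′} → Y′ < Y → ∀ Z → 0 < Y′ → PrimePowersDivide Y′ Z → Y′ ∣ Z) →
           ∀ Z → 0 < Y → PrimePowersDivide Y Z → Y ∣ Z
  induct 1 _ Z _ _ = 1∣ Z
  induct Y@(suc (suc _)) ih Z _ powers with prime-divisor Y (s≤s (s≤s z≤n))
  ... | q , q-prime , q∣Y@(divides Y′ Y≡Y′q)
    with powers q 1 q-prime (subst (_∣ Y) (sym (*-identityʳ q)) q∣Y)
  ...   | divides Z′ Z≡Z′q₁ =
    subst₂ _∣_ (sym Y≡Y′q) (sym Z≡Z′q) (*-monoˡ-∣ q (ih Y′<Y Z′ 0<Y′ (strip-prime q-prime powers′)))
    where
    Z≡Z′q : Z ≡ Z′ * q
    Z≡Z′q = trans Z≡Z′q₁ (cong (Z′ *_) (*-identityʳ q))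
    powers′ : PrimePowersDivide (Y′ * q) (Z′ * q)
    powers′ = subst₂ PrimePowersDivide Y≡Y′q Z≡Z′q powers
    0<Y′ : 0 < Y′
    0<Y′ = n≢0⇒n>0 λ Y′≡0 → 0≢1+n (sym (trans Y≡Y′q (cong (_* q) Y′≡0)))
    Y′<Y : Y′ < Y
    Y′<Y = subst (Y′ <_) (sym Y≡Y′q) (m<m*n Y′ q {{>-nonZero 0<Y′}} (prime≥2 q-prime))

exponent<bound : ∀ {q Y} e → 2 ≤ q → 0 < Y → q ^ e ∣ Y → e < Y
exponent<bound {q} {Y} e 2≤q 0<Y q^e∣Y =
  ≤-trans (n<2^n e) (≤-trans (^-monoˡ-≤ e 2≤q) (∣⇒≤ {{>-nonZero 0<Y}} q^e∣Y))

-- The constructive contrapositive of prime-powers⇒∣: when 0 < Z < Y, so that Y ∤ Z,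
-- a bounded search finds a prime power dividing Y but not Z.
prime-power-witness : ∀ {Y Z} → 0 < Z → Z < Y → ∃ λ q → ∃ λ e → Prime q × (q ^ e ∣ Y) × ¬ (q ^ e ∣ Z)
prime-power-witness {Y} {Z} 0<Z Z<Y
  with anyUpTo? (λ q → anyUpTo? (λ e → prime? q ×-dec q ^ e ∣? Y ×-dec ¬? (q ^ e ∣? Z)) (suc Y)) (suc Y)
... | yes (q , _ , e , _ , witness) = q , e , witness
... | no none = ⊥-elim (<⇒≱ Z<Y (∣⇒≤ {{>-nonZero 0<Z}} (prime-powers⇒∣ Y Z 0<Y powers)))
  where
  0<Y : 0 < Y
  0<Y = ≤-trans (s≤s z≤n) Z<Y
  powers : PrimePowersDivide Y Z
  powers q zero    _       _ = 1∣ Z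
  powers q (suc e) q-prime q^e∣Y with q ^ suc e ∣? Z
  ... | yes q^e∣Z = q^e∣Z
  ... | no  q^e∤Z = ⊥-elim (none (q , s≤s q≤Y , suc e , m<n⇒m<1+n e<Y , q-prime , q^e∣Y , q^e∤Z))
    where
    q≤Y : q ≤ Y
    q≤Y = ∣⇒≤ {{>-nonZero 0<Y}} (∣-trans (m∣m*n (q ^ e)) q^e∣Y)
    e<Y : suc e < Y
    e<Y = exponent<bound (suc e) (prime≥2 q-prime) 0<Y q^e∣Y

AtMostOneFailure : (ℕ → ℕ → Set) → ℕ → ℕ → Set
AtMostOneFailure G m p = ∀ {j j′} → j < m → j′ < m → j ≢ j′ → ¬ G j p → G j′ p

-- Induction on m: either the top index m
-- works, or some element fails there; it is then fine at every lower index and can be removed.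
pigeonhole : ∀ {G : ℕ → ℕ → Set} → (∀ j p → Dec (G j p)) →
             ∀ m (T : List ℕ) → length T < m → All (AtMostOneFailure G m) T →
             ∃ λ j → j < m × All (G j) T
pigeonhole _ zero _ () _
pigeonhole {G} G? (suc m) T |T|<1+m once with all? (G? m) T
... | yes all-good = m , ≤-refl , all-good
... | no  some-bad = drop (¬All⇒Any¬ (G? m) T some-bad)
  where
  lower : ∀ {p} → AtMostOneFailure G (suc m) p → AtMostOneFailure G m p
  lower h j<m j′<m = h (m<n⇒m<1+n j<m) (m<n⇒m<1+n j′<m)

  shorter : (bad : Any (λ p → ¬ G m p) T) → length (T ─ bad) < m
  shorter bad = ≤-pred (subst (_< suc m) (length-removeAt′ T (Any.index bad)) |T|<1+m)

  drop : (bad : Any (λ p → ¬ G m p) T) → ∃ λ j → j < suc m × All (G j) T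
  drop bad = conclude (lookupAny once bad) (pigeonhole G? m (T ─ bad) (shorter bad) (All.map lower (─⁺ bad once)))
    where
    conclude : AtMostOneFailure G (suc m) (Any.lookup bad) × ¬ G m (Any.lookup bad) →
               (∃ λ j → j < m × All (G j) (T ─ bad)) → ∃ λ j → j < suc m × All (G j) T
    conclude (once-p , ¬Gmp) (j , j<m , good) =
      j , j<1+m , ─⁻ bad (once-p ≤-refl j<1+m (>⇒≢ j<m) ¬Gmp) good
      where
      j<1+m : j < suc m
      j<1+m = m<n⇒m<1+n j<m

2^⌊log₂n⌋≤n : ∀ n → 0 < n → 2 ^ ⌊log₂ n ⌋ ≤ n
2^⌊log₂n⌋≤n = <-rec _ induct
  where
  induct : ∀ n → (∀ {m} → m < n → 0 < m → 2 ^ ⌊log₂ m ⌋ ≤ m) → 0 < n → 2 ^ ⌊log₂ n ⌋ ≤ n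
  induct 1 _ _ = ≤-refl
  induct n@(suc (suc k)) ih _ = begin
    2 ^ ⌊log₂ n ⌋      ≡⟨ cong (2 ^_) log-halves ⟩
    2 * 2 ^ ⌊log₂ h ⌋  ≤⟨ *-monoʳ-≤ 2 (ih (⌊n/2⌋<n (suc k)) (s≤s z≤n)) ⟩
    h + (h + 0)        ≤⟨ +-monoʳ-≤ h (≤-trans (≤-reflexive (+-identityʳ h)) (⌊n/2⌋≤⌈n/2⌉ n)) ⟩
    h + ⌈ n /2⌉        ≡⟨ ⌊n/2⌋+⌈n/2⌉≡n n ⟩
    n                  ∎
    where
    open ≤-Reasoning
    h : ℕ
    h = ⌊ n /2⌋
    log-halves : ⌊log₂ n ⌋ ≡ suc ⌊log₂ h ⌋
    log-halves = trans (sym (m+[n∸m]≡n (⌊log₂⌋-mono-≤ {2} {n} (s≤s (s≤s z≤n)))))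
                       (cong suc (sym (⌊log₂⌊n/2⌋⌋≡⌊log₂n⌋∸1 n)))

-- If for every ℓ there are ℓ distinct
-- numbers with property P, all at most 2 ^ 2 ^ (C * (ℓ + 1)), then for x ≥ 2 ^ 2 ^ (2 * C) the
-- choice ℓ = ⌊L / C⌋ - 1, where L = ⌊log₂ ⌊log₂ x⌋⌋, gives numbers ≤ x with L ≤ (3 * C + 1) * ℓ.
loglog-count : ∀ {P : ℕ → Set} C .{{_ : NonZero C}} →
  (∀ ℓ → ∃ λ ps → length ps ≡ ℓ × Unique ps × All (λ p → p ≤ 2 ^ (2 ^ (C * suc ℓ)) × P p) ps) →
  ∃ λ (k : ℕ) → ∃ λ (x₀ : ℕ) → ∀ (x : ℕ) → x₀ ≤ x →
    ∃ λ (ps : List ℕ) → Unique ps × All (λ p → p ≤ x × P p) ps × (⌊log₂ ⌊log₂ x ⌋ ⌋ ≤ suc k * length ps)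
loglog-count {P} C family = 3 * C , 2 ^ (2 ^ (2 * C)) , select
  where
  select : ∀ x → 2 ^ (2 ^ (2 * C)) ≤ x →
    ∃ λ ps → Unique ps × All (λ p → p ≤ x × P p) ps × (⌊log₂ ⌊log₂ x ⌋ ⌋ ≤ suc (3 * C) * length ps)
  select x x₀≤x with family (⌊log₂ ⌊log₂ x ⌋ ⌋ / C ∸ 1)
  ... | ps , |ps|≡ℓ , unique , bounded =
    ps , unique , All.map (λ (p≤ , Pp) → ≤-trans p≤ bound≤x , Pp) bounded ,
    subst (λ n → L ≤ suc (3 * C) * n) (sym |ps|≡ℓ) L≤[1+3C]ℓ
    where
    open ≤-Reasoning
    m : ℕ
    m = ⌊log₂ x ⌋
    L : ℕ
    L = ⌊log₂ m ⌋
    q : ℕ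
    q = L / C
    ℓ : ℕ
    ℓ = q ∸ 1
    2^2C≤m : 2 ^ (2 * C) ≤ m
    2^2C≤m = subst (_≤ m) (⌊log₂[2^n]⌋≡n (2 ^ (2 * C))) (⌊log₂⌋-mono-≤ x₀≤x)
    2≤q : 2 ≤ q
    2≤q = subst (_≤ q) (m*n/n≡m 2 C)
            (/-monoˡ-≤ C (subst (_≤ L) (⌊log₂[2^n]⌋≡n (2 * C)) (⌊log₂⌋-mono-≤ 2^2C≤m)))
    1+ℓ≡q : suc ℓ ≡ q
    1+ℓ≡q = m+[n∸m]≡n (≤-trans (s≤s z≤n) 2≤q)
    1≤ℓ : 1 ≤ ℓ
    1≤ℓ = ≤-pred (subst (2 ≤_) (sym 1+ℓ≡q) 2≤q)
    bound≤x : 2 ^ (2 ^ (C * suc ℓ)) ≤ x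
    bound≤x = begin
      2 ^ (2 ^ (C * suc ℓ)) ≡⟨ cong (λ n → 2 ^ (2 ^ (C * n))) 1+ℓ≡q ⟩
      2 ^ (2 ^ (C * q))     ≤⟨ ^-monoʳ-≤ 2 (^-monoʳ-≤ 2 (subst (_≤ L) (*-comm q C) (m/n*n≤m L C))) ⟩
      2 ^ (2 ^ L)           ≤⟨ ^-monoʳ-≤ 2 (2^⌊log₂n⌋≤n m (≤-trans (m^n>0 2 (2 * C)) 2^2C≤m)) ⟩
      2 ^ m                 ≤⟨ 2^⌊log₂n⌋≤n x (≤-trans (m^n>0 2 (2 ^ (2 * C))) x₀≤x) ⟩
      x                     ∎
    L≤[1+3C]ℓ : L ≤ suc (3 * C) * ℓ
    L≤[1+3C]ℓ = begin
      L                     ≡⟨ m≡m%n+[m/n]*n L C ⟩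
      L % C + q * C         ≤⟨ +-monoˡ-≤ (q * C) (<⇒≤ (m%n<n L C)) ⟩
      C + q * C             ≡⟨ *-comm (suc q) C ⟩
      C * suc q             ≡⟨ cong (λ n → C * suc n) 1+ℓ≡q ⟨
      C * suc (suc ℓ)       ≤⟨ *-monoʳ-≤ C (+-mono-≤ 1≤ℓ (+-mono-≤ 1≤ℓ (≤-reflexive (sym (+-identityʳ ℓ))))) ⟩
      C * (3 * ℓ)           ≡⟨ *-assoc C 3 ℓ ⟨
      C * 3 * ℓ             ≡⟨ cong (_* ℓ) (*-comm C 3) ⟩
      3 * C * ℓ             ≤⟨ m≤n+m (3 * C * ℓ) ℓ ⟩
      suc (3 * C) * ℓ       ∎

sum≤2^ : ∀ {m n} x y → m ≤ 2 ^ x → n ≤ 2 ^ y → m + n ≤ 2 ^ suc (x + y)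
sum≤2^ {m} {n} x y m≤ n≤ = begin
  m + n                     ≤⟨ +-mono-≤ (≤-trans m≤ (^-monoʳ-≤ 2 (m≤m+n x y))) (≤-trans n≤ (^-monoʳ-≤ 2 (m≤n+m y x))) ⟩
  2 ^ (x + y) + 2 ^ (x + y) ≡⟨ cong (2 ^ (x + y) +_) (+-identityʳ (2 ^ (x + y))) ⟨
  2 ^ suc (x + y)           ∎
  where open ≤-Reasoning

^≤2^* : ∀ m n → m ^ n ≤ 2 ^ (m * n)
^≤2^* m n = ≤-trans (^-monoˡ-≤ n (<⇒≤ (n<2^n m))) (≤-reflexive (^-*-assoc 2 m n))

∣i^n∣≡∣i∣^n : ∀ i n → ∣ i Z.^ n ∣ ≡ ∣ i ∣ ^ n
∣i^n∣≡∣i∣^n i zero    = refl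
∣i^n∣≡∣i∣^n i (suc n) = trans (ZP.abs-* i (i Z.^ n)) (cong (∣ i ∣ *_) (∣i^n∣≡∣i∣^n i n))

∣-abs-+ : ∀ {P} i j → P ∣ ∣ i ∣ → P ∣ ∣ j ∣ → P ∣ ∣ i Z.+ j ∣
∣-abs-+ {P} i j P∣i P∣j = ZS.∣⇒∣ᵤ (ZS.∣m∣n⇒∣m+n (ZS.∣ᵤ⇒∣ {Z.+ P} {i} P∣i) (ZS.∣ᵤ⇒∣ {Z.+ P} {j} P∣j))

∣-abs-- : ∀ {P} i j → P ∣ ∣ i ∣ → P ∣ ∣ j ∣ → P ∣ ∣ i Z.- j ∣
∣-abs-- {P} i j P∣i P∣j = ZS.∣⇒∣ᵤ (ZS.∣m∣n⇒∣m-n (ZS.∣ᵤ⇒∣ {Z.+ P} {i} P∣i) (ZS.∣ᵤ⇒∣ {Z.+ P} {j} P∣j))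

PrimeNotDividing : ℕ → ℕ → Set
PrimeNotDividing n p = Prime p × ¬ (p ∣ n)

module GoodPrimes (a b : ℤ) (a≢0 : a ≢ zeroℤ) (b≢0 : b ≢ zeroℤ) (∣a∣≢1 : ∣ a ∣ ≢ 1) where

  A B K : ℕ
  A = ∣ a ∣
  B = ∣ b ∣
  K = A + B + 2

  Y : ℕ → ℕ
  Y n = ∣ b Z.- a Z.^ n ∣

  -- F d = |a ^ d - 1| measures how far a ^ (n + d) is from a ^ n, and E t = F 1 * ⋯ * F t.
  F : ℕ → ℕ
  F d = ∣ a Z.^ d Z.- Z.1ℤ ∣

  E : ℕ → ℕ
  E zero    = 1
  E (suc t) = F (suc t) * E t

  2≤A : 2 ≤ A
  2≤A = ≤∧≢⇒< (n≢0⇒n>0 (a≢0 ∘ ZP.∣i∣≡0⇒i≡0)) (∣a∣≢1 ∘ sym)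

  0<B : 0 < B
  0<B = n≢0⇒n>0 (b≢0 ∘ ZP.∣i∣≡0⇒i≡0)

  0<K : 0 < K
  0<K = ≤-trans (s≤s z≤n) (m≤n+m 2 (A + B))

  -- a ^ d ≠ 1 for d ≥ 1 because |a| ≥ 2.
  0<F : ∀ d → 0 < d → 0 < F d
  0<F d 0<d = n≢0⇒n>0 λ F≡0 → [ (λ d≡0 → <⇒≢ 0<d (sym d≡0)) , ∣a∣≢1 ]
    (m^n≡1⇒n≡0∨m≡1 A d (trans (sym (∣i^n∣≡∣i∣^n a d))
      (cong ∣_∣ (ZP.i-j≡0⇒i≡j (a Z.^ d) Z.1ℤ (ZP.∣i∣≡0⇒i≡0 F≡0)))))

  0<E : ∀ t → 0 < E t
  0<E zero    = s≤s z≤n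
  0<E (suc t) = *-mono-≤ (0<F (suc t) (s≤s z≤n)) (0<E t)

  F∣E : ∀ {d} t → 0 < d → d ≤ t → F d ∣ E t
  F∣E {suc _} zero _ ()
  F∣E {d} (suc t) 0<d d≤1+t with d ≟ suc t
  ... | yes refl = m∣m*n (E t)
  ... | no  d≢1+t = ∣n⇒∣m*n (F (suc t)) (F∣E t 0<d (≤-pred (≤∧≢⇒< d≤1+t d≢1+t)))

  -- Divisibility properties of Y, from the identities  b = (b - a ^ n) + a ^ n  and
  -- (b - a ^ n) - (b - a ^ (n + d)) = a ^ n * (a ^ d - 1).
  Y∣⇒∣B : ∀ {P} n → P ∣ Y n → P ∣ A ^ n → P ∣ B
  Y∣⇒∣B n P∣Y P∣A^n = subst (_ ∣_) (cong ∣_∣ (split b (a Z.^ n)))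
    (∣-abs-+ (b Z.- a Z.^ n) (a Z.^ n) P∣Y (subst (_ ∣_) (sym (∣i^n∣≡∣i∣^n a n)) P∣A^n))
    where
    split : ∀ x y → (x Z.- y) Z.+ y ≡ x
    split = ZR.solve-∀

  Y∣⇒∣A^n : ∀ {P} n → P ∣ Y n → P ∣ B → P ∣ A ^ n
  Y∣⇒∣A^n n P∣Y P∣B = subst (_ ∣_) (trans (cong ∣_∣ (split b (a Z.^ n))) (∣i^n∣≡∣i∣^n a n))
    (∣-abs-- b (b Z.- a Z.^ n) P∣B P∣Y)
    where
    split : ∀ x y → x Z.- (x Z.- y) ≡ y
    split = ZR.solve-∀

  Y∣⇒∣A^nF : ∀ {P} n d → P ∣ Y n → P ∣ Y (n + d) → P ∣ A ^ n * F d
  Y∣⇒∣A^nF n d P∣Y P∣Y′ = subst (_ ∣_) difference (∣-abs-- (b Z.- a Z.^ n) (b Z.- a Z.^ (n + d)) P∣Y P∣Y′)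
    where
    factor : ∀ x y z → (x Z.- y) Z.- (x Z.- y Z.* z) ≡ y Z.* (z Z.- Z.1ℤ)
    factor = ZR.solve-∀
    open ≡-Reasoning
    difference : ∣ (b Z.- a Z.^ n) Z.- (b Z.- a Z.^ (n + d)) ∣ ≡ A ^ n * F d
    difference = begin
      ∣ (b Z.- a Z.^ n) Z.- (b Z.- a Z.^ (n + d)) ∣      ≡⟨ cong (λ z → ∣ (b Z.- a Z.^ n) Z.- (b Z.- z) ∣) (ZP.^-distribˡ-+-* a n d) ⟩
      ∣ (b Z.- a Z.^ n) Z.- (b Z.- a Z.^ n Z.* a Z.^ d) ∣ ≡⟨ cong ∣_∣ (factor b (a Z.^ n) (a Z.^ d)) ⟩
      ∣ a Z.^ n Z.* (a Z.^ d Z.- Z.1ℤ) ∣                  ≡⟨ ZP.abs-* (a Z.^ n) _ ⟩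
      ∣ a Z.^ n ∣ * F d                                   ≡⟨ cong (_* F d) (∣i^n∣≡∣i∣^n a n) ⟩
      A ^ n * F d                                         ∎

  -- A prime power dividing two of the Y's, with the prime not dividing a, divides the F of the
  -- gap between them.  This is the only way the Y's can share prime factors outside a.
  shared-prime-power : ∀ {p} f n d → PrimeNotDividing A p → p ^ f ∣ Y n → p ^ f ∣ Y (n + d) → p ^ f ∣ F d
  shared-prime-power f n d (p-prime , p∤A) p^f∣Y p^f∣Y′ =
    prime-power-cancel p-prime (p∤A ∘ prime∣^⇒∣ p-prime n) f (Y∣⇒∣A^nF n d p^f∣Y p^f∣Y′)

  prime-power-of-A : ∀ {q} f n → Prime q → q ∣ A → B < 2 ^ n → q ^ f ∣ Y n → q ^ f ∣ B
  prime-power-of-A {q} f n q-prime q∣A B<2^n q^f∣Y with f ≤? n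
  ... | yes f≤n = Y∣⇒∣B n q^f∣Y (∣-trans (^-monoʳ-∣ q f≤n) (^-monoˡ-∣ n q∣A))
  ... | no  f≰n = ⊥-elim (<⇒≱ B<2^n (≤-trans (^-monoˡ-≤ n (prime≥2 q-prime)) (∣⇒≤ {{>-nonZero 0<B}} q^n∣B)))
    where
    q^n∣B : q ^ n ∣ B
    q^n∣B = Y∣⇒∣B n (∣-trans (^-monoʳ-∣ q (≰⇒≥ f≰n)) q^f∣Y) (^-monoˡ-∣ n q∣A)

  -- A prime dividing Y n but not a is good: it does not divide a b (dividing b would force it
  -- to divide a ^ n), and b ≡ a ^ n modulo it.
  good-prime : ∀ {q} n → PrimeNotDividing A q → q ∣ Y n → GoodPrime a b q
  good-prime {q} n (q-prime , q∤A) q∣Y = q-prime , q∤ab , (n , q∣Y)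
    where
    q∤ab : ¬ (q ∣ ∣ a Z.* b ∣)
    q∤ab q∣ab with euclidsLemma A B q-prime (subst (q ∣_) (ZP.abs-* a b) q∣ab)
    ... | inj₁ q∣A = q∤A q∣A
    ... | inj₂ q∣B = q∤A (prime∣^⇒∣ q-prime n (Y∣⇒∣A^n n q∣Y q∣B))

  -- Size bounds.  Everything is compared with powers of two; K = |a| + |b| + 2 absorbs constants.
  exponent≤K* : ∀ {n} → 0 < n → suc (B + A * n) ≤ K * n
  exponent≤K* {suc n} _ = ≤-trans (m≤m+n _ _) (≤-reflexive (sym (expand A B n)))
    where
    expand : ∀ A B n → (A + B + 2) * suc n ≡ suc (B + A * suc n) + (B * n + 2 * n + 1)
    expand = solve-∀

  F≤2^ : ∀ {d} → 0 < d → F d ≤ 2 ^ (K * d)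
  F≤2^ {d} 0<d = begin
    F d                 ≤⟨ ZP.∣i-j∣≤∣i∣+∣j∣ (a Z.^ d) Z.1ℤ ⟩
    ∣ a Z.^ d ∣ + 1     ≡⟨ cong (_+ 1) (∣i^n∣≡∣i∣^n a d) ⟩
    A ^ d + 1           ≤⟨ sum≤2^ (A * d) 0 (^≤2^* A d) (≤-refl {1}) ⟩
    2 ^ suc (A * d + 0) ≤⟨ ^-monoʳ-≤ 2 (≤-trans (s≤s (≤-trans (≤-reflexive (+-identityʳ _)) (m≤n+m _ B))) (exponent≤K* 0<d)) ⟩
    2 ^ (K * d)         ∎
    where open ≤-Reasoning

  Y≤2^ : ∀ {n} → 0 < n → Y n ≤ 2 ^ (K * n)
  Y≤2^ {n} 0<n = begin
    Y n                 ≤⟨ ZP.∣i-j∣≤∣i∣+∣j∣ b (a Z.^ n) ⟩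
    B + ∣ a Z.^ n ∣     ≡⟨ cong (B +_) (∣i^n∣≡∣i∣^n a n) ⟩
    B + A ^ n           ≤⟨ sum≤2^ B (A * n) (<⇒≤ (n<2^n B)) (^≤2^* A n) ⟩
    2 ^ suc (B + A * n) ≤⟨ ^-monoʳ-≤ 2 (exponent≤K* 0<n) ⟩
    2 ^ (K * n)         ∎
    where open ≤-Reasoning

  -- Conversely Y n grows: 2 ^ n ≤ |a ^ n| ≤ |b| + Y n.
  2^≤B+Y : ∀ n → 2 ^ n ≤ B + Y n
  2^≤B+Y n = begin
    2 ^ n                             ≤⟨ ^-monoˡ-≤ n 2≤A ⟩
    A ^ n                             ≡⟨ ∣i^n∣≡∣i∣^n a n ⟨
    ∣ a Z.^ n ∣                       ≡⟨ cong ∣_∣ (split b (a Z.^ n)) ⟨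
    ∣ b Z.- (b Z.- a Z.^ n) ∣         ≤⟨ ZP.∣i-j∣≤∣i∣+∣j∣ b (b Z.- a Z.^ n) ⟩
    B + Y n                           ∎
    where
    open ≤-Reasoning
    split : ∀ x y → x Z.- (x Z.- y) ≡ y
    split = ZR.solve-∀

  -- E t is a product of t factors, each at most 2 ^ (K * t).
  E≤2^ : ∀ t → E t ≤ 2 ^ (K * t * t)
  E≤2^ t = ≤-trans (partial t ≤-refl) (≤-reflexive (^-*-assoc 2 (K * t) t))
    where
    partial : ∀ T → T ≤ t → E T ≤ (2 ^ (K * t)) ^ T
    partial zero    _     = ≤-refl
    partial (suc T) 1+T≤t = *-mono-≤ (≤-trans (F≤2^ (s≤s z≤n)) (^-monoʳ-≤ 2 (*-monoʳ-≤ K 1+T≤t)))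
                                     (partial T (≤-trans (n≤1+n T) 1+T≤t))

  -- The window of Y's used when t primes are known starts at N t, where 2 ^ (N t) exceeds B + B * E t.
  N : ℕ → ℕ
  N t = K * (2 + t * t)

  B+BE<2^N : ∀ t → B + B * E t < 2 ^ N t
  B+BE<2^N t = begin-strict
    B + B * E t                      ≤⟨ sum≤2^ B (B + K * t * t) (<⇒≤ (n<2^n B)) B*E≤ ⟩
    2 ^ suc (B + (B + K * t * t))    <⟨ ^-monoʳ-< 2 (s≤s (s≤s z≤n)) (n<1+n (suc X)) ⟩
    2 ^ suc (suc X)                  ≤⟨ ^-monoʳ-≤ 2 (≤-trans (m≤m+n (suc (suc X)) (A + A + 2)) (≤-reflexive (sym (expand A B t)))) ⟩
    2 ^ N t                          ∎
    where
    open ≤-Reasoning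
    X : ℕ
    X = B + (B + K * t * t)
    expand : ∀ A B t → (A + B + 2) * (2 + t * t) ≡ suc (suc (B + (B + (A + B + 2) * t * t))) + (A + A + 2)
    expand = solve-∀
    B*E≤ : B * E t ≤ 2 ^ (B + K * t * t)
    B*E≤ = ≤-trans (*-mono-≤ (<⇒≤ (n<2^n B)) (E≤2^ t)) (≤-reflexive (sym (^-distribˡ-+-* 2 B (K * t * t))))

  Bd : ℕ → ℕ
  Bd t = 2 ^ (K * (N t + t))

  Y≤Bd : ∀ {t j} → j ≤ t → Y (N t + j) ≤ Bd t
  Y≤Bd {t} j≤t = ≤-trans (Y≤2^ (≤-trans (*-mono-≤ 0<K (s≤s z≤n)) (m≤m+n (N t) _)))
                         (^-monoʳ-≤ 2 (*-monoʳ-≤ K (+-monoʳ-≤ (N t) j≤t)))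

  C : ℕ
  C = 3 * K

  0<C : 0 < C
  0<C = *-mono-≤ {1} {3} (s≤s z≤n) 0<K

  Bd≤2^2^ : ∀ t → Bd t ≤ 2 ^ (2 ^ (C * suc t))
  Bd≤2^2^ t = ^-monoʳ-≤ 2 (begin
    K * (N t + t)        ≤⟨ m≤m+n _ _ ⟩
    K * (N t + t) + _    ≡⟨ expand A B t ⟨
    2 * (v * v)          ≤⟨ *-mono-≤ (^-monoʳ-≤ 2 {1} (*-mono-≤ 0<K (s≤s z≤n))) (*-mono-≤ (<⇒≤ (n<2^n v)) (<⇒≤ (n<2^n v))) ⟩
    2 ^ v * (2 ^ v * 2 ^ v) ≡⟨ cong (2 ^ v *_) (^-distribˡ-+-* 2 v v) ⟨
    2 ^ v * 2 ^ (v + v)  ≡⟨ ^-distribˡ-+-* 2 v (v + v) ⟨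
    2 ^ (v + (v + v))    ≡⟨ cong (2 ^_) (triple K (suc t)) ⟩
    2 ^ (C * suc t)      ∎)
    where
    open ≤-Reasoning
    v : ℕ
    v = K * suc t
    expand : ∀ A B t → 2 * ((A + B + 2) * suc t * ((A + B + 2) * suc t)) ≡
             (A + B + 2) * ((A + B + 2) * (2 + t * t) + t) +
             ((A + B + 2) * (A + B + 2) * t * t + (A + B + 2) * t * (4 * (A + B) + 7))
    expand = solve-∀
    triple : ∀ k s → k * s + (k * s + k * s) ≡ 3 * k * s
    triple = solve-∀

  -- Among Y (N t + j), j ≤ t, pigeonhole yields one whose S-part divides E t; being larger than
  -- B * E t, it has a prime-power divisor outside B * E t, whose prime is the new good prime.
  module NewPrime (S : List ℕ) (S-ok : All (PrimeNotDividing A) S) where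

    t : ℕ
    t = length S

    W : ℕ → ℕ
    W j = Y (N t + j)

    BE<W : ∀ j → B * E t < W j
    BE<W j = +-cancelˡ-< B (B * E t) (W j)
      (≤-trans (B+BE<2^N t) (≤-trans (^-monoʳ-≤ 2 (m≤m+n (N t) j)) (2^≤B+Y (N t + j))))

    B<2^ : ∀ j → B < 2 ^ (N t + j)
    B<2^ j = ≤-trans (s≤s (m≤m+n B (B * E t))) (≤-trans (B+BE<2^N t) (^-monoʳ-≤ 2 (m≤m+n (N t) j)))

    -- p is tame at j: every power of p dividing W j divides E t (exponents bounded to keep it decidable).
    Tame : ℕ → ℕ → Set
    Tame j p = ∀ {e} → e < suc (W j) → p ^ e ∣ W j → p ^ e ∣ E t

    tame? : ∀ j p → Dec (Tame j p)
    tame? j p = allUpTo? (λ e → (p ^ e ∣? W j) →-dec (p ^ e ∣? E t)) (suc (W j))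

    -- Prime powers shared by two members of the window divide E t, since their gap is at most t.
    shared-ordered : ∀ {p i i′} f → PrimeNotDividing A p → i < i′ → i′ ≤ t →
                     p ^ f ∣ W i → p ^ f ∣ W i′ → p ^ f ∣ E t
    shared-ordered {p} {i} {i′} f ok i<i′ i′≤t p^f∣W p^f∣W′ = ∣-trans
      (shared-prime-power f (N t + i) (i′ ∸ i) ok p^f∣W (subst (λ n → p ^ f ∣ Y n) gap p^f∣W′))
      (F∣E t (m<n⇒0<n∸m i<i′) (≤-trans (m∸n≤m i′ i) i′≤t))
      where
      gap : N t + i′ ≡ N t + i + (i′ ∸ i)
      gap = trans (cong (N t +_) (sym (m+[n∸m]≡n (<⇒≤ i<i′)))) (sym (+-assoc (N t) i (i′ ∸ i)))

    shared : ∀ {p j j′} f → PrimeNotDividing A p → j ≢ j′ → j ≤ t → j′ ≤ t →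
             p ^ f ∣ W j → p ^ f ∣ W j′ → p ^ f ∣ E t
    shared {j = j} {j′} f ok j≢j′ j≤t j′≤t p^f∣W p^f∣W′ with <-cmp j j′
    ... | tri< j<j′ _ _ = shared-ordered f ok j<j′ j′≤t p^f∣W p^f∣W′
    ... | tri≈ _ j≡j′ _ = ⊥-elim (j≢j′ j≡j′)
    ... | tri> _ _ j′<j = shared-ordered f ok j′<j j≤t p^f∣W′ p^f∣W

    -- A prime of S is untame at no more than one index of the window: if it is untame at j,
    -- each power of it dividing W j′ either divides W j (so is shared) or is larger than every
    -- power dividing W j, and then W j would be tame after all.
    tame-unique : ∀ {p} → PrimeNotDividing A p → AtMostOneFailure Tame (suc t) p
    tame-unique {p} ok {j} {j′} j≤t j′≤t j≢j′ untame {e} _ p^e∣W′ with p ^ e ∣? W j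
    ... | yes p^e∣W = shared e ok j≢j′ (≤-pred j≤t) (≤-pred j′≤t) p^e∣W p^e∣W′
    ... | no  p^e∤W = ⊥-elim (untame λ {e₀} _ p^e₀∣W →
            shared e₀ ok j≢j′ (≤-pred j≤t) (≤-pred j′≤t) p^e₀∣W (∣-trans (^-monoʳ-∣ p (below {e₀} p^e₀∣W)) p^e∣W′))
      where
      below : ∀ {e₀} → p ^ e₀ ∣ W j → e₀ ≤ e
      below p^e₀∣W = ≮⇒≥ λ e<e₀ → p^e∤W (∣-trans (^-monoʳ-∣ p (<⇒≤ e<e₀)) p^e₀∣W)

    new-prime : ∃ λ q → q ∉ S × q ≤ Bd t × GoodPrime a b q
    new-prime with pigeonhole tame? (suc t) S ≤-refl (All.map tame-unique S-ok)
    ... | j , j<1+t , S-tame with prime-power-witness (*-mono-≤ 0<B (0<E t)) (BE<W j)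
    ...   | q , zero  , _ , _ , 1∤BE = ⊥-elim (1∤BE (1∣ (B * E t)))
    ...   | q , suc e , q-prime , q^e∣W , q^e∤BE = q , q∉S , q≤Bd , good-prime (N t + j) (q-prime , q∤A) q∣W
      where
      0<W : 0 < W j
      0<W = ≤-trans (s≤s z≤n) (BE<W j)
      q∣W : q ∣ W j
      q∣W = ∣-trans (m∣m*n (q ^ e)) q^e∣W
      q≤Bd : q ≤ Bd t
      q≤Bd = ≤-trans (∣⇒≤ {{>-nonZero 0<W}} q∣W) (Y≤Bd (≤-pred j<1+t))
      q∤A : ¬ (q ∣ A)
      q∤A q∣A = q^e∤BE (∣m⇒∣m*n (E t) (prime-power-of-A (suc e) (N t + j) q-prime q∣A (B<2^ j) q^e∣W))
      q∉S : q ∉ S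
      q∉S q∈S = q^e∤BE (∣n⇒∣m*n B (All.lookup S-tame q∈S e<1+W q^e∣W))
        where
        e<1+W : suc e < suc (W j)
        e<1+W = m<n⇒m<1+n (exponent<bound (suc e) (prime≥2 q-prime) 0<W q^e∣W)

  good⇒not-dividing : ∀ {p} → GoodPrime a b p → PrimeNotDividing A p
  good⇒not-dividing {p} (p-prime , p∤ab , _) =
    p-prime , λ p∣A → p∤ab (subst (p ∣_) (sym (ZP.abs-* a b)) (∣m⇒∣m*n B p∣A))

  good-primes : ∀ ℓ → ∃ λ ps → length ps ≡ ℓ × Unique ps ×
                               All (λ p → p ≤ 2 ^ (2 ^ (C * suc ℓ)) × GoodPrime a b p) ps
  good-primes zero = [] , refl , AllPairs.[] , All.[]
  good-primes (suc ℓ) with good-primes ℓ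
  ... | ps , refl , unique , bounded = add (NewPrime.new-prime ps (All.map (good⇒not-dividing ∘ proj₂) bounded))
    where
    grow : 2 ^ (2 ^ (C * suc ℓ)) ≤ 2 ^ (2 ^ (C * suc (suc ℓ)))
    grow = ^-monoʳ-≤ 2 (^-monoʳ-≤ 2 (*-monoʳ-≤ C (n≤1+n (suc ℓ))))
    add : (∃ λ q → q ∉ ps × q ≤ Bd ℓ × GoodPrime a b q) →
          ∃ λ ps′ → length ps′ ≡ suc ℓ × Unique ps′ ×
                    All (λ p → p ≤ 2 ^ (2 ^ (C * suc (suc ℓ))) × GoodPrime a b p) ps′
    add (q , q∉ps , q≤Bd , q-good) =
      q ∷ ps , refl , ¬Any⇒All¬ ps q∉ps AllPairs.∷ unique ,
      (≤-trans q≤Bd (≤-trans (Bd≤2^2^ ℓ) grow) , q-good) All.∷ All.map (λ (p≤ , p-good) → ≤-trans p≤ grow , p-good) bounded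

theorem1p2 : (a b : ℤ) → a ≢ zeroℤ → b ≢ zeroℤ → ∣ a ∣ ≢ 1 →
    ∃ λ (k : ℕ) → ∃ λ (x₀ : ℕ) → ∀ (x : ℕ) → x₀ ≤ x →
    ∃ λ (ps : List ℕ) → Unique ps × All (λ p → p ≤ x × GoodPrime a b p) ps ×
    (⌊log₂ ⌊log₂ x ⌋ ⌋ ≤ suc k * length ps)
theorem1p2 a b a≢0 b≢0 ∣a∣≢1 = loglog-count C {{>-nonZero 0<C}} good-primes
  where open GoodPrimes a b a≢0 b≢0 ∣a∣≢1
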